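{- Let $b,c \in \mathbb{N}$ with $b \ge 2$ and $c \ge 5$, and let $p = 2 - \frac{2}{c}$. If $b < \frac{2+p^c}{p}$, then $\mathrm{dor}(1,b) \le c-1$.
   Context: For integers $1 \le a \le b$, an $(a,b)$-triple is a triple $(x, ax+d, bx+2d)$ with $x,d$ positive integers. A coloring admits a monochromatic $(a,b)$-triple if all three entries of some $(a,b)$-triple receive the same color. The pair $(a,b)$ is $r$-regular if every $r$-coloring of $\mathbb{N}$ admits a monochromatic $(a,b)$-triple. The degree of regularity $\mathrm{dor}(a,b)$ is the largest $r$ such that $(a,b)$ is $r$-regular, and $\mathrm{dor}(a,b)=\infty$ if $(a,b)$ is $r$-regular for all $r$. -}

module Defs where

open import Data.Nat as ℕ using (ℕ; zero; suc; _+_; _*_; _≤_; NonZero)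
open import Data.Fin using (Fin)
open import Data.Product using (Σ; _×_; ∃-syntax)
open import Relation.Binary.PropositionalEquality using (_≡_)
open import Data.Integer using (+_)
import Data.Rational as ℚ
open ℚ using (ℚ)

-- A coloring of ℕ with r colors. Only values at positive integers matter,
-- since every entry of an (a,b)-triple is positive.
Coloring : ℕ → Set
Coloring r = ℕ → Fin r

MonoTriple : ∀ {r} → ℕ → ℕ → Coloring r → Set
MonoTriple a b χ =
  ∃[ x ] ∃[ d ] (1 ≤ x × 1 ≤ d ×
    χ x ≡ χ (a * x + d) × χ x ≡ χ (b * x + 2 * d))

Regular : ℕ → ℕ → ℕ → Set
Regular a b r = (χ : Coloring r) → MonoTriple a b χ

-- dor(a,b) ≤ m  (covers dor = ∞: then the bound fails)
DorAtMost : ℕ → ℕ → ℕ → Set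
DorAtMost a b m = ∀ r → Regular a b r → r ≤ m

_^ℚ_ : ℚ → ℕ → ℚ
q ^ℚ zero = ℚ.1ℚ
q ^ℚ suc n = q ℚ.* (q ^ℚ n)

pval : (c : ℕ) → .{{NonZero c}} → ℚ
pval c = (+ 2 ℚ./ 1) ℚ.- (+ 2 ℚ./ c)

{-# OPTIONS --safe #-}
-- Colour n by ⌊log₂ n⌋ mod c. In a (1,b)-triple (x, x+d, bx+2d) with 2 ≤ b ≤ 2^(c-1), the
-- entries y = x+d and z = bx+2d satisfy 2y ≤ z ≤ 2^(c-1) y, so ⌊log₂ z⌋ - ⌊log₂ y⌋ lies
-- in [1, c-1] and y, z get different colours. The hypothesis on b forces b < 2^(c-1):
-- with c = m+1 and p = 2m/c it reads b < 2/p + p^m, and 2/p + p^m ≤ 2^m follows from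
-- 2 m^m ≤ (m+1)^m and 2(m+1) ≤ 2^m m (this needs only c ≥ 3).
module Submission where

open import Defs

module PowerBounds where
  open import Data.Nat
  open import Data.Nat.Properties
  open import Data.Nat.Tactic.RingSolver using (solve-∀)
  open import Algebra.Properties.CommutativeSemigroup *-commutativeSemigroup
    using () renaming (interchange to *-interchange; x∙yz≈y∙xz to *-exchange)
  open import Relation.Binary.PropositionalEquality using (_≡_; refl; cong; trans)

  [m*n]^k≡m^k*n^k : ∀ m n k → (m * n) ^ k ≡ m ^ k * n ^ k
  [m*n]^k≡m^k*n^k m n zero    = refl
  [m*n]^k≡m^k*n^k m n (suc k) =
    trans (cong (m * n *_) ([m*n]^k≡m^k*n^k m n k)) (*-interchange m n (m ^ k) (n ^ k))

  a^k*[a+k]≤a*[1+a]^k : ∀ a k → a ^ k * (a + k) ≤ a * suc a ^ k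
  a^k*[a+k]≤a*[1+a]^k a zero    = ≤-reflexive (trans (*-comm 1 (a + 0)) (cong (_* 1) (+-identityʳ a)))
  a^k*[a+k]≤a*[1+a]^k a (suc k) = begin
    a * a ^ k * (a + suc k)              ≤⟨ m≤m+n _ (k * a ^ k) ⟩
    a * a ^ k * (a + suc k) + k * a ^ k  ≡⟨ expand a k (a ^ k) ⟩
    suc a * (a ^ k * (a + k))            ≤⟨ *-monoʳ-≤ (suc a) (a^k*[a+k]≤a*[1+a]^k a k) ⟩
    suc a * (a * suc a ^ k)              ≡⟨ *-exchange (suc a) a (suc a ^ k) ⟩
    a * suc a ^ suc k                    ∎
    where
    open ≤-Reasoning
    expand : ∀ a k P → a * P * (a + suc k) + k * P ≡ suc a * (P * (a + k))
    expand = solve-∀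

  2*m^m≤[1+m]^m : ∀ m .{{_ : NonZero m}} → 2 * m ^ m ≤ suc m ^ m
  2*m^m≤[1+m]^m m = *-cancelˡ-≤ m (begin
    m * (2 * m ^ m)   ≡⟨ rearrange m (m ^ m) ⟩
    m ^ m * (m + m)   ≤⟨ a^k*[a+k]≤a*[1+a]^k m m ⟩
    m * suc m ^ m     ∎)
    where
    open ≤-Reasoning
    rearrange : ∀ m P → m * (2 * P) ≡ P * (m + m)
    rearrange = solve-∀

  2*[1+m]≤2^m*m : ∀ {m} → 2 ≤ m → 2 * suc m ≤ 2 ^ m * m
  2*[1+m]≤2^m*m {m} 2≤m = begin
    2 * suc m    ≤⟨ *-monoʳ-≤ 2 (+-monoˡ-≤ m (≤-trans (s≤s z≤n) 2≤m)) ⟩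
    2 * (m + m)  ≡⟨ double m ⟩
    4 * m        ≤⟨ *-monoˡ-≤ m (^-monoʳ-≤ 2 2≤m) ⟩
    2 ^ m * m    ∎
    where
    open ≤-Reasoning
    double : ∀ m → 2 * (m + m) ≡ 4 * m
    double = solve-∀

  -- 2/p + p^m ≤ 2^m for p = 2m/(m+1), multiplied through by 2m(m+1)^m.
  2*[1+m]^[1+m]+[2m]^[1+m]≤2^m*[2m*[1+m]^m] : ∀ {m} → 2 ≤ m →
    2 * suc m ^ suc m + (2 * m) ^ suc m ≤ 2 ^ m * (2 * m * suc m ^ m)
  2*[1+m]^[1+m]+[2m]^[1+m]≤2^m*[2m*[1+m]^m] {m@(suc _)} 2≤m = begin
    2 * (suc m * A) + 2 * m * (2 * m) ^ m  ≡⟨ cong (λ t → 2 * (suc m * A) + 2 * m * t) ([m*n]^k≡m^k*n^k 2 m m) ⟩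
    2 * (suc m * A) + 2 * m * (K * m ^ m)  ≡⟨ regroup m A K (m ^ m) ⟩
    2 * suc m * A + K * m * (2 * m ^ m)    ≤⟨ +-mono-≤ (*-monoˡ-≤ A (2*[1+m]≤2^m*m 2≤m))
                                                       (*-monoʳ-≤ (K * m) (2*m^m≤[1+m]^m m)) ⟩
    K * m * A + K * m * A                  ≡⟨ collect m A K ⟩
    K * (2 * m * A)                        ∎
    where
    open ≤-Reasoning
    A = suc m ^ m
    K = 2 ^ m
    regroup : ∀ m A K B → 2 * (suc m * A) + 2 * m * (K * B) ≡ 2 * suc m * A + K * m * (2 * B)
    regroup = solve-∀
    collect : ∀ m A K → K * m * A + K * m * A ≡ K * (2 * m * A)
    collect = solve-∀

  b<2^m : ∀ {b m} → 2 ≤ m →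
    b * (2 * m) * suc m ^ suc m < (2 * suc m ^ suc m + (2 * m) ^ suc m) * suc m → b < 2 ^ m
  b<2^m {b} {m} 2≤m h = *-cancelʳ-< D b (2 ^ m) (begin-strict
    b * D                                <⟨ *-cancelʳ-< (suc m) (b * D) _
                                              (≤-<-trans (≤-reflexive (regroup b m (suc m ^ m))) h) ⟩
    2 * suc m ^ suc m + (2 * m) ^ suc m  ≤⟨ 2*[1+m]^[1+m]+[2m]^[1+m]≤2^m*[2m*[1+m]^m] 2≤m ⟩
    2 ^ m * D                            ∎)
    where
    open ≤-Reasoning
    D = 2 * m * suc m ^ m
    regroup : ∀ b m A → b * (2 * m * A) * suc m ≡ b * (2 * m) * (suc m * A)
    regroup = solve-∀

module Log₂Coloring where
  open import Data.Nat
  open import Data.Nat.Properties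
  open import Data.Nat.DivMod using (_mod_; m≡m%n+[m/n]*n)
  open import Data.Nat.Divisibility using (_∣_; divides; ∣⇒≤)
  open import Data.Nat.Logarithm using (⌊log₂_⌋; ⌊log₂⌋-mono-≤; ⌊log₂[2*b]⌋≡1+⌊log₂b⌋)
  open import Data.Fin using (inject≤)
  open import Data.Fin.Properties using (fromℕ<-injective; inject≤-injective)
  open import Data.Product using (_,_)
  open import Relation.Nullary using (¬_; yes; no; contradiction)
  open import Relation.Binary.PropositionalEquality using (_≡_; _≢_; cong; cong₂; sym; trans; module ≡-Reasoning)

  %≡%⇒∣∸ : ∀ {j k} d .{{_ : NonZero d}} → j % d ≡ k % d → d ∣ k ∸ j
  %≡%⇒∣∸ {j} {k} d eq = divides (k / d ∸ j / d) (begin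
    k ∸ j                                     ≡⟨ cong₂ _∸_ (m≡m%n+[m/n]*n k d) (m≡m%n+[m/n]*n j d) ⟩
    (k % d + k / d * d) ∸ (j % d + j / d * d) ≡⟨ cong (λ r → (r + k / d * d) ∸ (j % d + j / d * d)) (sym eq) ⟩
    (j % d + k / d * d) ∸ (j % d + j / d * d) ≡⟨ [m+n]∸[m+o]≡n∸o (j % d) _ _ ⟩
    k / d * d ∸ j / d * d                     ≡⟨ *-distribʳ-∸ d (k / d) (j / d) ⟨
    (k / d ∸ j / d) * d                       ∎)
    where open ≡-Reasoning

  %-injective-on-window : ∀ {j k} d .{{_ : NonZero d}} → j < k → k < j + d → j % d ≢ k % d
  %-injective-on-window {j} {k} d j<k k<j+d eq =
    <⇒≱ (m<n+o⇒m∸n<o k j k<j+d) (∣⇒≤ {{>-nonZero (m<n⇒0<n∸m j<k)}} (%≡%⇒∣∸ d eq))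

  ⌊log₂[2^k*n]⌋≡k+⌊log₂n⌋ : ∀ k n .{{_ : NonZero n}} → ⌊log₂ (2 ^ k * n) ⌋ ≡ k + ⌊log₂ n ⌋
  ⌊log₂[2^k*n]⌋≡k+⌊log₂n⌋ zero    n = cong ⌊log₂_⌋ (*-identityˡ n)
  ⌊log₂[2^k*n]⌋≡k+⌊log₂n⌋ (suc k) n = begin
    ⌊log₂ (2 * 2 ^ k * n) ⌋    ≡⟨ cong ⌊log₂_⌋ (*-assoc 2 (2 ^ k) n) ⟩
    ⌊log₂ (2 * (2 ^ k * n)) ⌋  ≡⟨ ⌊log₂[2*b]⌋≡1+⌊log₂b⌋ (2 ^ k * n) {{m*n≢0 (2 ^ k) n {{m^n≢0 2 k}}}} ⟩
    suc ⌊log₂ (2 ^ k * n) ⌋    ≡⟨ cong suc (⌊log₂[2^k*n]⌋≡k+⌊log₂n⌋ k n) ⟩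
    suc k + ⌊log₂ n ⌋          ∎
    where open ≡-Reasoning

  log₂-coloring : ∀ c .{{_ : NonZero c}} → Coloring c
  log₂-coloring c n = ⌊log₂ n ⌋ mod c

  log₂-coloring-separates : ∀ {m y z} .{{_ : NonZero y}} → 2 * y ≤ z → z ≤ 2 ^ m * y →
    log₂-coloring (suc m) y ≢ log₂-coloring (suc m) z
  log₂-coloring-separates {m} {y} {z} 2y≤z z≤2^my eq =
    %-injective-on-window (suc m) lg[y]<lg[z] lg[z]<lg[y]+1+m (fromℕ<-injective _ _ _ _ eq)
    where
    lg[y]<lg[z] : ⌊log₂ y ⌋ < ⌊log₂ z ⌋
    lg[y]<lg[z] = begin-strict
      ⌊log₂ y ⌋        <⟨ n<1+n _ ⟩
      suc ⌊log₂ y ⌋    ≡⟨ ⌊log₂[2*b]⌋≡1+⌊log₂b⌋ y ⟨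
      ⌊log₂ (2 * y) ⌋  ≤⟨ ⌊log₂⌋-mono-≤ 2y≤z ⟩
      ⌊log₂ z ⌋        ∎
      where open ≤-Reasoning
    lg[z]<lg[y]+1+m : ⌊log₂ z ⌋ < ⌊log₂ y ⌋ + suc m
    lg[z]<lg[y]+1+m = begin-strict
      ⌊log₂ z ⌋              ≤⟨ ⌊log₂⌋-mono-≤ z≤2^my ⟩
      ⌊log₂ (2 ^ m * y) ⌋    ≡⟨ ⌊log₂[2^k*n]⌋≡k+⌊log₂n⌋ m y ⟩
      m + ⌊log₂ y ⌋          <⟨ n<1+n _ ⟩
      suc m + ⌊log₂ y ⌋      ≡⟨ +-comm (suc m) _ ⟩
      ⌊log₂ y ⌋ + suc m      ∎
      where open ≤-Reasoning

  log₂-coloring-avoids : ∀ {b m} → 2 ≤ b → b ≤ 2 ^ m → ¬ MonoTriple 1 b (log₂-coloring (suc m))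
  log₂-coloring-avoids {b} {m} 2≤b b≤2^m (x@(suc _) , d , _ , _ , χx≡χy , χx≡χz) =
    log₂-coloring-separates {y = y} {z} 2y≤z z≤2^my (trans (sym χx≡χy) χx≡χz)
    where
    open ≤-Reasoning
    y = 1 * x + d
    z = b * x + 2 * d
    2y≤z : 2 * y ≤ z
    2y≤z = begin
      2 * (1 * x + d)        ≡⟨ *-distribˡ-+ 2 (1 * x) d ⟩
      2 * (1 * x) + 2 * d    ≡⟨ cong (λ t → 2 * t + 2 * d) (*-identityˡ x) ⟩
      2 * x + 2 * d          ≤⟨ +-monoˡ-≤ (2 * d) (*-monoˡ-≤ x 2≤b) ⟩
      b * x + 2 * d          ∎
    z≤2^my : z ≤ 2 ^ m * y
    z≤2^my = begin
      b * x + 2 * d          ≤⟨ +-monoʳ-≤ (b * x) (*-monoˡ-≤ d 2≤b) ⟩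
      b * x + b * d          ≡⟨ cong (λ t → b * t + b * d) (*-identityˡ x) ⟨
      b * (1 * x) + b * d    ≡⟨ *-distribˡ-+ b (1 * x) d ⟨
      b * (1 * x + d)        ≤⟨ *-monoˡ-≤ y b≤2^m ⟩
      2 ^ m * y              ∎

  Regular-antimono : ∀ {a b c r} → c ≤ r → Regular a b r → Regular a b c
  Regular-antimono c≤r reg χ with reg (λ n → inject≤ (χ n) c≤r)
  ... | x , d , 1≤x , 1≤d , e₁ , e₂ =
    x , d , 1≤x , 1≤d , inject≤-injective c≤r c≤r _ _ e₁ , inject≤-injective c≤r c≤r _ _ e₂

  avoiding-coloring⇒DorAtMost : ∀ {a b c} (χ : Coloring (suc c)) → ¬ MonoTriple a b χ → DorAtMost a b c
  avoiding-coloring⇒DorAtMost {a} {b} {c} χ avoids r reg with r ≤? c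
  ... | yes r≤c = r≤c
  ... | no  r≰c = contradiction (Regular-antimono {a} {b} (≰⇒> r≰c) reg χ) avoids

  dor[1,b]≤m : ∀ {b m} → 2 ≤ b → b ≤ 2 ^ m → DorAtMost 1 b m
  dor[1,b]≤m {b} 2≤b b≤2^m =
    avoiding-coloring⇒DorAtMost {1} {b} (log₂-coloring _) (log₂-coloring-avoids 2≤b b≤2^m)

module ClearingDenominators where
  open import Data.Nat as ℕ using (zero; suc; NonZero)
  import Data.Nat.Properties as ℕ
  open import Data.Integer as ℤ using (+_)
  import Data.Integer.Properties as ℤ
  open import Data.Integer.Tactic.RingSolver using (solve-∀)
  open import Data.Rational as ℚ using (toℚᵘ)
  import Data.Rational.Properties as ℚ
  open import Data.Rational.Unnormalised as ℚᵘ using (_/_; _≃_; *≡*; *<*)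
  open import Data.Rational.Unnormalised.Properties as ℚᵘ using (/-cong; ≃-refl; ≃-reflexive; module ≃-Reasoning)
  open import Relation.Binary.PropositionalEquality using (_≡_; refl; cong; cong₂; sym; trans; subst₂; module ≡-Reasoning)

  /-homo-* : ∀ a a′ d d′ .{{_ : NonZero d}} .{{_ : NonZero d′}} →
    (+ a / d) ℚᵘ.* (+ a′ / d′) ≃ (+ (a ℕ.* a′) / (d ℕ.* d′)) {{ℕ.m*n≢0 d d′}}
  /-homo-* a a′ (suc d) (suc d′) = ≃-reflexive (/-cong (sym (ℤ.pos-* a a′)) refl)

  n+a/d≃[n*d+a]/d : ∀ n a d .{{_ : NonZero d}} → (+ n / 1) ℚᵘ.+ (+ a / d) ≃ + (n ℕ.* d ℕ.+ a) / d
  n+a/d≃[n*d+a]/d n a d@(suc _) = ≃-reflexive (/-cong numerator (ℕ.*-identityˡ d))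
    where
    numerator : + n ℤ.* + d ℤ.+ + a ℤ.* + 1 ≡ + (n ℕ.* d ℕ.+ a)
    numerator = trans (cong₂ ℤ._+_ (sym (ℤ.pos-* n d)) (ℤ.*-identityʳ (+ a))) (sym (ℤ.pos-+ (n ℕ.* d) a))

  toℚᵘ-^ℚ : ∀ {q} a d .{{_ : NonZero d}} → toℚᵘ q ≃ + a / d →
    ∀ k → toℚᵘ (q ^ℚ k) ≃ (+ (a ℕ.^ k) / (d ℕ.^ k)) {{ℕ.m^n≢0 d k}}
  toℚᵘ-^ℚ a d q≃a/d zero    = ≃-refl
  toℚᵘ-^ℚ {q} a d q≃a/d (suc k) = begin
    toℚᵘ (q ℚ.* q ^ℚ k)                                       ≈⟨ ℚ.toℚᵘ-homo-* q (q ^ℚ k) ⟩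
    toℚᵘ q ℚᵘ.* toℚᵘ (q ^ℚ k)                                 ≈⟨ ℚᵘ.*-cong q≃a/d (toℚᵘ-^ℚ a d q≃a/d k) ⟩
    (+ a / d) ℚᵘ.* (+ (a ℕ.^ k) / (d ℕ.^ k)) {{ℕ.m^n≢0 d k}}  ≈⟨ /-homo-* a (a ℕ.^ k) d (d ℕ.^ k) {{_}} {{ℕ.m^n≢0 d k}} ⟩
    (+ (a ℕ.^ suc k) / (d ℕ.^ suc k)) {{ℕ.m^n≢0 d (suc k)}}   ∎
    where open ≃-Reasoning

  2-2/[1+m]≃2m/[1+m] : ∀ m → + 2 / 1 ℚᵘ.- + 2 / suc m ≃ + (2 ℕ.* m) / suc m
  2-2/[1+m]≃2m/[1+m] m = *≡* (begin
    (+ 2 ℤ.* (+ 1 ℤ.+ + m) ℤ.+ ℤ.- + 2 ℤ.* + 1) ℤ.* (+ 1 ℤ.+ + m)  ≡⟨ cross-multiplied (+ m) ⟩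
    + 2 ℤ.* + m ℤ.* (+ 1 ℤ.+ + m)                                  ≡⟨ cong₂ ℤ._*_ (sym (ℤ.pos-* 2 m))
                                                                          (cong (λ t → + suc t) (sym (ℕ.+-identityʳ m))) ⟩
    + (2 ℕ.* m) ℤ.* + suc (m ℕ.+ 0)                                ∎)
    where
    open ≡-Reasoning
    cross-multiplied : ∀ M →
      (+ 2 ℤ.* (+ 1 ℤ.+ M) ℤ.+ ℤ.- + 2 ℤ.* + 1) ℤ.* (+ 1 ℤ.+ M) ≡ + 2 ℤ.* M ℤ.* (+ 1 ℤ.+ M)
    cross-multiplied = solve-∀

  a/b<c/d⇒a*d<c*b : ∀ a b c d .{{_ : NonZero b}} .{{_ : NonZero d}} → + a / b ℚᵘ.< + c / d → a ℕ.* d ℕ.< c ℕ.* b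
  a/b<c/d⇒a*d<c*b a b@(suc _) c d@(suc _) (*<* ad<cb) =
    ℤ.drop‿+<+ (subst₂ ℤ._<_ (sym (ℤ.pos-* a d)) (sym (ℤ.pos-* c b)) ad<cb)

  toℚᵘ-pval : ∀ m → toℚᵘ (pval (suc m)) ≃ + (2 ℕ.* m) / suc m
  toℚᵘ-pval m = begin
    toℚᵘ ((+ 2 ℚ./ 1) ℚ.- (+ 2 ℚ./ suc m))            ≈⟨ ℚ.toℚᵘ-homo-+ (+ 2 ℚ./ 1) (ℚ.- (+ 2 ℚ./ suc m)) ⟩
    toℚᵘ (+ 2 ℚ./ 1) ℚᵘ.+ toℚᵘ (ℚ.- (+ 2 ℚ./ suc m))  ≈⟨ ℚᵘ.+-cong (ℚ.toℚᵘ-fromℚᵘ (+ 2 / 1)) toℚᵘ-[-2/c] ⟩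
    + 2 / 1 ℚᵘ.- + 2 / suc m                          ≈⟨ 2-2/[1+m]≃2m/[1+m] m ⟩
    + (2 ℕ.* m) / suc m                               ∎
    where
    open ≃-Reasoning
    toℚᵘ-[-2/c] : toℚᵘ (ℚ.- (+ 2 ℚ./ suc m)) ≃ ℚᵘ.- (+ 2 / suc m)
    toℚᵘ-[-2/c] = ℚᵘ.≃-trans (ℚ.toℚᵘ-homo‿- (+ 2 ℚ./ suc m)) (ℚᵘ.-‿cong (ℚ.toℚᵘ-fromℚᵘ (+ 2 / suc m)))

  pval-hypothesis⇒cleared : ∀ b m →
    (+ b ℚ./ 1) ℚ.* pval (suc m) ℚ.< (+ 2 ℚ./ 1) ℚ.+ (pval (suc m) ^ℚ suc m) →
    b ℕ.* (2 ℕ.* m) ℕ.* suc m ℕ.^ suc m ℕ.< (2 ℕ.* suc m ℕ.^ suc m ℕ.+ (2 ℕ.* m) ℕ.^ suc m) ℕ.* suc m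
  pval-hypothesis⇒cleared b m h =
    a/b<c/d⇒a*d<c*b _ (suc m) _ c^c {{_}} {{c^c≢0}} (ℚᵘ.<-respʳ-≃ rhs (ℚᵘ.<-respˡ-≃ lhs (ℚ.toℚᵘ-mono-< h)))
    where
    open ≃-Reasoning
    p = pval (suc m)
    c^c = suc m ℕ.^ suc m
    c^c≢0 : NonZero c^c
    c^c≢0 = ℕ.m^n≢0 (suc m) (suc m)
    lhs : toℚᵘ ((+ b ℚ./ 1) ℚ.* p) ≃ + (b ℕ.* (2 ℕ.* m)) / suc m
    lhs = begin
      toℚᵘ ((+ b ℚ./ 1) ℚ.* p)                 ≈⟨ ℚ.toℚᵘ-homo-* (+ b ℚ./ 1) p ⟩
      toℚᵘ (+ b ℚ./ 1) ℚᵘ.* toℚᵘ p             ≈⟨ ℚᵘ.*-cong (ℚ.toℚᵘ-fromℚᵘ (+ b / 1)) (toℚᵘ-pval m) ⟩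
      (+ b / 1) ℚᵘ.* (+ (2 ℕ.* m) / suc m)     ≈⟨ /-homo-* b (2 ℕ.* m) 1 (suc m) ⟩
      + (b ℕ.* (2 ℕ.* m)) / (1 ℕ.* suc m)      ≈⟨ ≃-reflexive (/-cong refl (ℕ.*-identityˡ (suc m))) ⟩
      + (b ℕ.* (2 ℕ.* m)) / suc m              ∎
    rhs : toℚᵘ ((+ 2 ℚ./ 1) ℚ.+ (p ^ℚ suc m)) ≃ (+ (2 ℕ.* c^c ℕ.+ (2 ℕ.* m) ℕ.^ suc m) / c^c) {{c^c≢0}}
    rhs = begin
      toℚᵘ ((+ 2 ℚ./ 1) ℚ.+ (p ^ℚ suc m))                      ≈⟨ ℚ.toℚᵘ-homo-+ (+ 2 ℚ./ 1) (p ^ℚ suc m) ⟩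
      toℚᵘ (+ 2 ℚ./ 1) ℚᵘ.+ toℚᵘ (p ^ℚ suc m)                  ≈⟨ ℚᵘ.+-cong (ℚ.toℚᵘ-fromℚᵘ (+ 2 / 1))
                                                                      (toℚᵘ-^ℚ (2 ℕ.* m) (suc m) (toℚᵘ-pval m) (suc m)) ⟩
      (+ 2 / 1) ℚᵘ.+ (+ ((2 ℕ.* m) ℕ.^ suc m) / c^c) {{c^c≢0}}  ≈⟨ n+a/d≃[n*d+a]/d 2 ((2 ℕ.* m) ℕ.^ suc m) c^c {{c^c≢0}} ⟩
      (+ (2 ℕ.* c^c ℕ.+ (2 ℕ.* m) ℕ.^ suc m) / c^c) {{c^c≢0}}   ∎

open import Data.Nat using (ℕ; suc; s≤s; z≤n; _≤_; _∸_; NonZero)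
open import Data.Integer using (+_)
open import Data.Rational using (_/_; _*_; _+_; _<_)
open import Data.Nat.Properties using (≤-trans; ≤-pred; <⇒≤)
open PowerBounds using (b<2^m)
open Log₂Coloring using (dor[1,b]≤m)
open ClearingDenominators using (pval-hypothesis⇒cleared)

theorem3 : (b c : ℕ) → .{{_ : NonZero c}} → 2 ≤ b → 5 ≤ c →
    (+ b / 1) * pval c < (+ 2 / 1) + (pval c ^ℚ c) →
    DorAtMost 1 b (c ∸ 1)
theorem3 b (suc m) 2≤b 5≤c hyp =
  dor[1,b]≤m 2≤b (<⇒≤ (b<2^m 2≤m (pval-hypothesis⇒cleared b m hyp)))
  where
  2≤m : 2 ≤ m
  2≤m = ≤-trans (s≤s (s≤s z≤n)) (≤-pred 5≤c)
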